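{- For each integer $m\ge 1$ there is an integer $n_0(m)$ such that every (abstract) rotation system of size at least $n_0(m)$ has a rotation subsystem equivalent to one of $\mathbf{C}_m$, $\mathbf{T}_m$, $(\mathbf{C}_m)^{ -1}$, or $(\mathbf{T}_m)^{ -1}$.
   Context: An (abstract) rotation system $\Pi$ on a finite set of integers $\{i_1,\ldots,i_n\}$ with $i_1<\cdots<i_n$ (its ground set; $n$ is its size) is an $n$-tuple $(\Pi(i_1),\ldots,\Pi(i_n))$, where each $\Pi(i_j)$ is a cyclic permutation (cyclic ordering) of $\{i_1,\ldots,i_n\}\setminus\{i_j\}$. Two rotation systems $\Pi,\Pi'$ are equivalent if there is a relabelling (bijection) of the ground elements of $\Pi'$ that turns $\Pi'$ into $\Pi$. The inverse $\Pi^{ -1}$ is $((\Pi(i_1))^{ -1},\ldots,(\Pi(i_n))^{ -1})$, where $(\Pi(i_j))^{ -1}$ is the inverse (reversed) cyclic permutation. For a subset $S$ of the ground set, the rotation subsystem induced by $S$ assigns to each $x\in S$ the cyclic order on $S\setminus\{x\}$ obtained from $\Pi(x)$ by deleting the elements not in $S$. For $m\ge 1$, $\mathbf{C}_m$ is the rotation system on $\{1,\ldots,m\}$ with $\mathbf{C}_m(i)=1\,2\cdots(i-1)\,(i+1)\cdots m$ (as a cyclic order) for each $i$, and $\mathbf{T}_m$ is the rotation system on $\{1,\ldots,m\}$ with $\mathbf{T}_m(i)=m\,(m-1)\cdots(i+1)\,1\,2\cdots(i-1)$ (as a cyclic order) for each $i$. -}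

module Defs where

open import Data.Nat using (ℕ)
open import Data.Fin using (Fin; _<_; _≟_)
open import Data.Fin.Properties using (_<?_)
open import Data.List using (List; filter; map; reverse; drop; take; _++_; allFin)
open import Data.List.Membership.Propositional using (_∈_)
open import Data.List.Relation.Unary.Unique.Propositional using (Unique)
open import Data.List.Relation.Unary.Any using (any?)
open import Data.Product using (Σ; ∃; _×_)
open import Function.Bundles using (_⇔_)
open import Function.Definitions using (Injective)
open import Relation.Binary.PropositionalEquality using (_≡_; _≢_)
open import Relation.Nullary.Decidable using (¬?)

-- A cyclic order (cyclic permutation) is represented by a list listing its
-- elements in cyclic order; two lists represent the same cyclic order iff
-- one is a rotation of the other.
CycEq : {A : Set} → List A → List A → Set
CycEq xs ys = ∃ λ k → ys ≡ drop k xs ++ take k xs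

IsCyclicOrderOmitting : {n : ℕ} → Fin n → List (Fin n) → Set
IsCyclicOrderOmitting x l = Unique l × (∀ y → (y ∈ l) ⇔ (y ≢ x))

RotSys : ℕ → Set
RotSys n = Σ (Fin n → List (Fin n)) λ Π → ∀ x → IsCyclicOrderOmitting x (Π x)

RawRotSys : ℕ → Set
RawRotSys m = Fin m → List (Fin m)

InImage? : {m n : ℕ} (h : Fin m → Fin n) (y : Fin n) → _
InImage? h y = any? (λ j → h j ≟ y) (allFin _)

induced : {m n : ℕ} → RotSys n → (Fin m → Fin n) → Fin m → List (Fin n)
induced Π h i = filter (InImage? h) (Data.Product.proj₁ Π (h i))

-- Π has a rotation subsystem equivalent to Σ': there is a subset S of the
-- ground set (S = image of the injection h) and the relabelling h from the
-- ground set of Σ' to S turns Σ' into the induced subsystem on S.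
HasSubsystemEquivTo : {m n : ℕ} → RotSys n → RawRotSys m → Set
HasSubsystemEquivTo {m} {n} Π Σ' =
  ∃ λ (h : Fin m → Fin n) → Injective _≡_ _≡_ h ×
    (∀ i → CycEq (induced Π h i) (map h (Σ' i)))

-- C_m on {1..m} (here Fin m = {0..m-1}, order-preservingly):
-- C_m(i) = 1 2 ... (i-1) (i+1) ... m
Cm : (m : ℕ) → RawRotSys m
Cm m i = filter (λ j → ¬? (j ≟ i)) (allFin m)

Tm : (m : ℕ) → RawRotSys m
Tm m i = filter (λ j → i <? j) (reverse (allFin m)) ++ filter (λ j → j <? i) (allFin m)

inv : {m : ℕ} → RawRotSys m → RawRotSys m
inv Σ' i = reverse (Σ' i)

module Submission where

-- A cyclic order is encoded by the Boolean orientation of its triples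
-- (orient), and is determined by these orientations up to rotation
-- (orient-determines-cycle).  Colour each 4-element subset a < b < c < d of
-- the ground set in four ways: by the orientation of the other three elements
-- at a, at b, at c or at d (apexColouring).  Ramsey's theorem, proved here for
-- sublists of lists (ramsey, ramsey-simultaneous), gives m + 5 elements on which
-- all four colourings are constant.  The cocycle relation between the
-- orientations of four points forces the colours to be a, a, b, b (Cocycle).
-- So the orientation at i of j < k < l depends only on whether i lies below
-- or above k; such a system is determined by the pair (a , b) (realise,
-- realise-type), and the four pairs are those of C_m, T_m and their inverses
-- (Cm-type, Tm-type, inverse-type).

open import Defs
open import Algebra.Bundles using (CommutativeRing; AbelianGroup)
import Algebra.Solver.CommutativeMonoid
open import Data.Bool using (Bool; true; false; not; _xor_)
import Data.Bool.Properties as Bool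
open import Data.Empty using (⊥-elim)
open import Data.Fin using (Fin; zero; suc; _<_; _≟_; toℕ; inject≤)
open import Data.Fin.Properties using (<-cmp; <⇒≢; <-trans; <-asym; <-irrefl; _<?_; toℕ-inject≤)
open import Data.List using (List; []; _∷_; _++_; [_]; map; filter; reverse; allFin; lookup; length; drop; take)
open import Data.List.Properties using (unfold-reverse; ++-identityʳ; length-tabulate)
open import Data.List.Membership.Propositional using (_∈_; _∉_)
open import Data.List.Membership.Propositional.Properties
  using (∈-++⁺ˡ; ∈-++⁺ʳ; ∈-++⁻; ∈-∃++; ∈-filter⁺; ∈-filter⁻; ∈-allFin; ∈-map⁺; ∈-map⁻)
open import Data.List.Relation.Binary.Disjoint.Propositional using (Disjoint)
open import Data.List.Relation.Binary.Permutation.Propositional using (↭-sym; ↭⇒↭ₛ)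
open import Data.List.Relation.Binary.Permutation.Propositional.Properties using (↭-reverse)
import Data.List.Relation.Binary.Permutation.Setoid.Properties as PermProps
open import Data.List.Relation.Binary.Sublist.Propositional using (_⊆_; []; _∷_; _∷ʳ_; ⊆-refl; ⊆-trans; minimum)
open import Data.List.Relation.Binary.Sublist.Propositional.Properties using (All-resp-⊆)
open import Data.List.Relation.Unary.All using (All; []; _∷_) renaming (lookup to lookupAll)
import Data.List.Relation.Unary.All.Properties as All
open import Data.List.Relation.Unary.AllPairs using (AllPairs; []; _∷_; tail)
import Data.List.Relation.Unary.AllPairs.Properties as AllPairs
open import Data.List.Relation.Unary.Any using (Any; here; there; satisfied)
import Data.List.Relation.Unary.Any as Any
import Data.List.Relation.Unary.Any.Properties as AnyProps
open import Data.List.Relation.Unary.Unique.Propositional using (Unique)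
open import Data.List.Relation.Unary.Unique.Propositional.Properties using (Unique[x∷xs]⇒x∉xs)
import Data.List.Relation.Unary.Unique.Propositional.Properties as Unique
open import Data.Nat using (ℕ; zero; suc; pred; _+_; _≤_; z≤n; s≤s)
open import Data.Nat.Properties using (_≤?_; ≰⇒>; <⇒≤; ≤-trans; ≤-reflexive; +-cancelˡ-≤; +-monoˡ-≤; +-suc; m≤m+n; m≤n+m)
open import Data.Product using (∃; _×_; _,_; proj₁; proj₂)
open import Data.Sum using (_⊎_; inj₁; inj₂)
open import Function using (_∘_; id)
open import Function.Bundles using (Equivalence; mk⇔)
open import Function.Definitions using (Injective)
import Level
open import Relation.Binary.Definitions using (DecidableEquality; tri<; tri≈; tri>)
open import Relation.Binary.PropositionalEquality
  using (_≡_; _≢_; refl; cong; cong₂; sym; trans; subst; setoid; module ≡-Reasoning)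
open import Relation.Nullary using (yes; no; ¬_; Dec)
open import Relation.Nullary.Decidable using (¬?)
open import Relation.Unary using (Pred; Decidable)

Homogeneous : {A : Set} → ℕ → (List A → Bool) → List A → Bool → Set
Homogeneous k c H b = ∀ t → t ⊆ H → length t ≡ k → c t ≡ b

homogeneous-⊆ : ∀ {A : Set} {k c} {H H′ : List A} {b} →
                H′ ⊆ H → Homogeneous k c H b → Homogeneous k c H′ b
homogeneous-⊆ H′⊆H hom t t⊆H′ = hom t (⊆-trans t⊆H′ H′⊆H)

RamseyBound : ℕ → ℕ → Set₁
RamseyBound k M = ∃ λ N → ∀ {A : Set} (U : List A) → N ≤ length U → (c : List A → Bool) →
                  ∃ λ H → H ⊆ U × M ≤ length H × ∃ (Homogeneous k c H)

pigeonhole : ∀ M a b → M + M ≤ a + b → M ≤ a ⊎ M ≤ b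
pigeonhole M a b le with M ≤? a
... | yes M≤a = inj₁ M≤a
... | no  M≰a = inj₂ (+-cancelˡ-≤ M M b (≤-trans le (+-monoˡ-≤ b (<⇒≤ (≰⇒> M≰a)))))

module EndHomogeneous {A : Set} (k : ℕ) (c : List A → Bool) where

  -- X is end-homogeneous: each (k+1)-sublist of X has a colour determined by
  -- its first element x, namely the colour b recorded for x.
  data EndHom : List A → Set where
    []   : EndHom []
    cons : ∀ {x X} b → Homogeneous k (c ∘ (x ∷_)) X b → EndHom X → EndHom (x ∷ X)

  select : ∀ {X} → Bool → EndHom X → List A
  select b [] = []
  select b (cons {x} b′ _ E) with b′ Bool.≟ b
  ... | yes _ = x ∷ select b E
  ... | no  _ = select b E

  select-⊆ : ∀ {X} b (E : EndHom X) → select b E ⊆ X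
  select-⊆ b [] = []
  select-⊆ b (cons {x} b′ _ E) with b′ Bool.≟ b
  ... | yes _ = refl ∷ select-⊆ b E
  ... | no  _ = x ∷ʳ select-⊆ b E

  select-length : ∀ {X} (E : EndHom X) →
                  length (select true E) + length (select false E) ≡ length X
  select-length [] = refl
  select-length (cons true  _ E) = cong suc (select-length E)
  select-length (cons false _ E) = trans (+-suc _ _) (cong suc (select-length E))

  select-homogeneous : ∀ {X} b (E : EndHom X) → Homogeneous (suc k) c (select b E) b
  select-homogeneous b [] .[] [] ()
  select-homogeneous b (cons {x} b′ hom E) t t⊆ len with b′ Bool.≟ b | t⊆
  ... | yes refl | refl ∷ t′⊆ = hom _ (⊆-trans t′⊆ (select-⊆ b E)) (cong pred len)
  ... | yes refl | _ ∷ʳ t⊆′ = select-homogeneous b E t t⊆′ len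
  ... | no _     | t⊆′ = select-homogeneous b E t t⊆′ len

open EndHomogeneous using (EndHom; cons; select; select-⊆; select-length; select-homogeneous)

end-homogeneous : ∀ k → (∀ M → RamseyBound k M) → ∀ L → ∃ λ N →
                  ∀ {A : Set} (U : List A) → N ≤ length U → (c : List A → Bool) →
                  ∃ λ X → X ⊆ U × L ≤ length X × EndHom k c X
end-homogeneous k ramsey-k zero = 0 , λ U _ c → [] , minimum U , z≤n , EndHomogeneous.[]
end-homogeneous k ramsey-k (suc L) with end-homogeneous k ramsey-k L
... | N , extend with ramsey-k N
... | N′ , homogeneous-tail = suc N′ , build
  where
  build : ∀ {A : Set} (U : List A) → suc N′ ≤ length U → (c : List A → Bool) →
          ∃ λ X → X ⊆ U × suc L ≤ length X × EndHom k c X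
  build (x ∷ U) (s≤s N′≤U) c with homogeneous-tail U N′≤U (c ∘ (x ∷_))
  ... | H , H⊆U , N≤H , b , hom with extend H N≤H c
  ...   | X , X⊆H , L≤X , E =
          x ∷ X , refl ∷ ⊆-trans X⊆H H⊆U , s≤s L≤X , cons b (homogeneous-⊆ X⊆H hom) E

-- For k + 1 one takes an
-- end-homogeneous list of length 2M and keeps the majority colour.
ramsey : ∀ k M → RamseyBound k M
ramsey zero M = M , λ U M≤U c → U , ⊆-refl , M≤U , c [] , λ t _ → constant c t
  where
  constant : ∀ {A : Set} (c : List A → Bool) t → length t ≡ 0 → c t ≡ c []
  constant c [] _ = refl
ramsey (suc k) M with end-homogeneous k (ramsey k) (M + M)
... | N , endHom = N , majority
  where
  majority : ∀ {A : Set} (U : List A) → N ≤ length U → (c : List A → Bool) →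
             ∃ λ H → H ⊆ U × M ≤ length H × ∃ (Homogeneous (suc k) c H)
  majority U N≤U c with endHom U N≤U c
  ... | X , X⊆U , 2M≤X , E with pigeonhole M _ _ (≤-trans 2M≤X (≤-reflexive (sym (select-length k c E))))
  ...   | inj₁ M≤T = select k c true E , ⊆-trans (select-⊆ k c true E) X⊆U , M≤T , true , select-homogeneous k c true E
  ...   | inj₂ M≤F = select k c false E , ⊆-trans (select-⊆ k c false E) X⊆U , M≤F , false , select-homogeneous k c false E

-- The bound is astronomically large; it is kept opaque
-- so that the type checker never tries to evaluate it.
opaque
  ramsey-simultaneous : ∀ k M r → ∃ λ N →
    ∀ {A : Set} (U : List A) → N ≤ length U → (cs : Fin r → List A → Bool) →
    ∃ λ H → H ⊆ U × M ≤ length H × (∀ j → ∃ (Homogeneous k (cs j) H))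
  ramsey-simultaneous k M zero = M , λ U M≤U cs → U , ⊆-refl , M≤U , λ ()
  ramsey-simultaneous k M (suc r) with ramsey k M
  ... | N₀ , homogeneous₀ with ramsey-simultaneous k N₀ r
  ... | N , homogeneousRest = N , both
    where
    both : ∀ {A : Set} (U : List A) → N ≤ length U → (cs : Fin (suc r) → List A → Bool) →
           ∃ λ H → H ⊆ U × M ≤ length H × (∀ j → ∃ (Homogeneous k (cs j) H))
    both U N≤U cs with homogeneousRest U N≤U (cs ∘ suc)
    ... | H′ , H′⊆U , N₀≤H′ , homRest with homogeneous₀ H′ N₀≤H′ (cs zero)
    ...   | H , H⊆H′ , M≤H , hom₀ = H , ⊆-trans H⊆H′ H′⊆U , M≤H , homAll
      where
      homAll : ∀ j → ∃ (Homogeneous k (cs j) H)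
      homAll zero    = hom₀
      homAll (suc j) = proj₁ (homRest j) , homogeneous-⊆ H⊆H′ (proj₂ (homRest j))

module _ {A : Set} where

  ∉⇒≢ : ∀ {x y : A} {xs} → x ∉ xs → y ∈ xs → x ≢ y
  ∉⇒≢ x∉xs y∈xs refl = x∉xs y∈xs

  ∈-tail : ∀ {x y : A} {xs} → y ∈ x ∷ xs → x ≢ y → y ∈ xs
  ∈-tail (here y≡x) x≢y = ⊥-elim (x≢y (sym y≡x))
  ∈-tail (there y∈xs) _ = y∈xs

  unique-split : ∀ (xs ys : List A) → Unique (xs ++ ys) → Unique xs × Unique ys × Disjoint xs ys
  unique-split []       ys u = [] , u , λ { (() , _) }
  unique-split (x ∷ xs) ys (x≢ ∷ u) with unique-split xs ys u
  ... | uxs , uys , disjoint = (All.++⁻ˡ xs x≢ ∷ uxs) , uys , λ where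
        (here refl , x∈ys) → Unique[x∷xs]⇒x∉xs (x≢ ∷ u) (∈-++⁺ʳ xs x∈ys)
        (there v∈xs , v∈ys) → disjoint (v∈xs , v∈ys)

  unique-reverse : ∀ {xs : List A} → Unique xs → Unique (reverse xs)
  unique-reverse {xs} = PermProps.Unique-resp-↭ (setoid A) (↭⇒↭ₛ (↭-sym (↭-reverse xs)))

  unique-⊆ : ∀ {xs ys : List A} → xs ⊆ ys → Unique ys → Unique xs
  unique-⊆ []         []         = []
  unique-⊆ (y ∷ʳ xs⊆) (_ ∷ u)    = unique-⊆ xs⊆ u
  unique-⊆ (refl ∷ xs⊆) (x≢ ∷ u) = All-resp-⊆ xs⊆ x≢ ∷ unique-⊆ xs⊆ u

-- Boolean identities for orientations.  Since xor is a commutative monoid and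
-- not p = true xor p definitionally, they follow by monoid normalisation.
module XorMonoid =
  Algebra.Solver.CommutativeMonoid (AbelianGroup.commutativeMonoid (CommutativeRing.+-abelianGroup Bool.xor-∧-commutativeRing))

-- Transposing two of three compared elements negates the orientation.
xor-swap-negates : ∀ p q r → (not p xor r) xor q ≡ not ((p xor q) xor r)
xor-swap-negates = solve 4 (λ t p q r → ((t ⊕ p) ⊕ r) ⊕ q ⊜ t ⊕ ((p ⊕ q) ⊕ r)) refl true
  where open XorMonoid

-- Negating all three comparisons negates the orientation.
xor-not-negates : ∀ p q r → (not p xor not q) xor not r ≡ not ((p xor q) xor r)
xor-not-negates p q r = trans (cong (_xor not r) (Bool.xor-annihilates-not p q)) (sym (Bool.not-distribʳ-xor (p xor q) r))

-- A xor of six atoms each occurring twice vanishes.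
xor-pairs : ∀ p q r s t u →
  ((((p xor q) xor r) xor ((p xor s) xor t)) xor ((r xor u) xor t)) xor ((q xor u) xor s) ≡ false
xor-pairs p q r s t u = begin
  ((((p xor q) xor r) xor ((p xor s) xor t)) xor ((r xor u) xor t)) xor ((q xor u) xor s)
    ≡⟨ solve 6 (λ p q r s t u → ((((p ⊕ q) ⊕ r) ⊕ ((p ⊕ s) ⊕ t)) ⊕ ((r ⊕ u) ⊕ t)) ⊕ ((q ⊕ u) ⊕ s)
                  ⊜ (p ⊕ p) ⊕ ((q ⊕ q) ⊕ ((r ⊕ r) ⊕ ((s ⊕ s) ⊕ ((t ⊕ t) ⊕ (u ⊕ u)))))) refl p q r s t u ⟩
  (p xor p) xor ((q xor q) xor ((r xor r) xor ((s xor s) xor ((t xor t) xor (u xor u)))))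
    ≡⟨ cong₂ _xor_ (Bool.xor-same p) (cong₂ _xor_ (Bool.xor-same q) (cong₂ _xor_ (Bool.xor-same r)
         (cong₂ _xor_ (Bool.xor-same s) (cong₂ _xor_ (Bool.xor-same t) (Bool.xor-same u))))) ⟩
  false ∎
  where
  open ≡-Reasoning
  open XorMonoid

module Orientation {A : Set} (_≟_ : DecidableEquality A) where

  before : List A → A → A → Bool
  before []       y z = false
  before (x ∷ xs) y z with x ≟ y
  ... | yes _ = true
  ... | no  _ with x ≟ z
  ...   | yes _ = false
  ...   | no  _ = before xs y z

  -- For distinct a, y, z of l: whether they occur in l in one of the orders
  -- a y z, y z a, z a y, i.e. in the cyclic order (a y z).  Transposing two of
  -- them negates one comparison and permutes the others, so negates orient.
  orient : List A → A → A → A → Bool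
  orient l a y z = (before l a y xor before l y z) xor before l a z

  before-here : ∀ x xs z → before (x ∷ xs) x z ≡ true
  before-here x xs z with x ≟ x
  ... | yes _   = refl
  ... | no  x≢x = ⊥-elim (x≢x refl)

  before-here₂ : ∀ x xs y → x ≢ y → before (x ∷ xs) y x ≡ false
  before-here₂ x xs y x≢y with x ≟ y
  ... | yes x≡y = ⊥-elim (x≢y x≡y)
  ... | no  _ with x ≟ x
  ...   | yes _   = refl
  ...   | no  x≢x = ⊥-elim (x≢x refl)

  before-there : ∀ x xs y z → x ≢ y → x ≢ z → before (x ∷ xs) y z ≡ before xs y z
  before-there x xs y z x≢y x≢z with x ≟ y
  ... | yes x≡y = ⊥-elim (x≢y x≡y)
  ... | no  _ with x ≟ z
  ...   | yes x≡z = ⊥-elim (x≢z x≡z)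
  ...   | no  _   = refl

  before-flip : ∀ l y z → y ≢ z → y ∈ l → before l z y ≡ not (before l y z)
  before-flip (x ∷ xs) y z y≢z y∈l = cases (x ≟ y) (x ≟ z)
    where
    open ≡-Reasoning
    cases : Dec (x ≡ y) → Dec (x ≡ z) → before (x ∷ xs) z y ≡ not (before (x ∷ xs) y z)
    cases (yes refl) _ = trans (before-here₂ x xs z y≢z) (cong not (sym (before-here x xs z)))
    cases (no x≢y) (yes refl) = trans (before-here x xs y) (cong not (sym (before-here₂ x xs y x≢y)))
    cases (no x≢y) (no x≢z) = begin
      before (x ∷ xs) z y       ≡⟨ before-there x xs z y x≢z x≢y ⟩
      before xs z y             ≡⟨ before-flip xs y z y≢z (∈-tail y∈l x≢y) ⟩
      not (before xs y z)       ≡⟨ cong not (sym (before-there x xs y z x≢y x≢z)) ⟩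
      not (before (x ∷ xs) y z) ∎

  before-∷-cong : ∀ x xs ys y z → before xs y z ≡ before ys y z → before (x ∷ xs) y z ≡ before (x ∷ ys) y z
  before-∷-cong x xs ys y z eq with x ≟ y
  ... | yes _ = refl
  ... | no  _ with x ≟ z
  ...   | yes _ = refl
  ...   | no  _ = eq

  before-filter : ∀ {P : Pred A Level.zero} (P? : Decidable P) l {y z} → P y → P z →
                  before (filter P? l) y z ≡ before l y z
  before-filter P? [] _ _ = refl
  before-filter {P} P? (x ∷ xs) {y} {z} py pz with P? x
  ... | yes _  = before-∷-cong x _ xs y z (before-filter P? xs py pz)
  ... | no ¬px = trans (before-filter P? xs py pz)
                       (sym (before-there x xs y z (λ { refl → ¬px py }) (λ { refl → ¬px pz })))

  before-++ˡ : ∀ xs ys y z → y ∈ xs ⊎ z ∈ xs → before (xs ++ ys) y z ≡ before xs y z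
  before-++ˡ []       ys y z (inj₁ ())
  before-++ˡ []       ys y z (inj₂ ())
  before-++ˡ (x ∷ xs) ys y z y∨z∈xs with x ≟ y
  ... | yes _ = refl
  ... | no x≢y with x ≟ z
  ...   | yes _ = refl
  ...   | no x≢z = before-++ˡ xs ys y z (tails y∨z∈xs)
    where
    tails : y ∈ x ∷ xs ⊎ z ∈ x ∷ xs → y ∈ xs ⊎ z ∈ xs
    tails (inj₁ y∈) = inj₁ (∈-tail y∈ x≢y)
    tails (inj₂ z∈) = inj₂ (∈-tail z∈ x≢z)

  before-++ʳ : ∀ xs ys y z → y ∉ xs → z ∉ xs → before (xs ++ ys) y z ≡ before ys y z
  before-++ʳ []       ys y z _ _ = refl
  before-++ʳ (x ∷ xs) ys y z y∉ z∉ =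
    trans (before-there x (xs ++ ys) y z (λ { refl → y∉ (here refl) }) (λ { refl → z∉ (here refl) }))
          (before-++ʳ xs ys y z (y∉ ∘ there) (z∉ ∘ there))

  before-true : ∀ xs y z → y ∈ xs → z ∉ xs → before xs y z ≡ true
  before-true (x ∷ xs) y z y∈ z∉ with x ≟ y
  ... | yes _ = refl
  ... | no x≢y with x ≟ z
  ...   | yes refl = ⊥-elim (z∉ (here refl))
  ...   | no  _    = before-true xs y z (∈-tail y∈ x≢y) (z∉ ∘ there)

  before-false : ∀ xs y z → z ∈ xs → y ∉ xs → before xs y z ≡ false
  before-false (x ∷ xs) y z z∈ y∉ with x ≟ y
  ... | yes refl = ⊥-elim (y∉ (here refl))
  ... | no _ with x ≟ z
  ...   | yes _   = refl
  ...   | no x≢z  = before-false xs y z (∈-tail z∈ x≢z) (y∉ ∘ there)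

  ∈-reverse⁺ : ∀ {y} {xs : List A} → y ∈ xs → y ∈ reverse xs
  ∈-reverse⁺ = AnyProps.reverse⁺

  ∈-reverse⁻ : ∀ {y} {xs : List A} → y ∈ reverse xs → y ∈ xs
  ∈-reverse⁻ = AnyProps.reverse⁻

  before-reverse : ∀ l y z → Unique l → y ∈ l → z ∈ l → y ≢ z → before (reverse l) y z ≡ before l z y
  before-reverse (x ∷ xs) y z (x≢ ∷ u) y∈ z∈ y≢z rewrite unfold-reverse x xs = cases (x ≟ y) (x ≟ z)
    where
    x∉xs : x ∉ xs
    x∉xs = Unique[x∷xs]⇒x∉xs (x≢ ∷ u)
    x∉rev : x ∉ reverse xs
    x∉rev = x∉xs ∘ ∈-reverse⁻
    cases : Dec (x ≡ y) → Dec (x ≡ z) → before (reverse xs ++ [ x ]) y z ≡ before (x ∷ xs) z y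
    cases (yes refl) _ = begin
      before (reverse xs ++ [ x ]) x z ≡⟨ before-++ˡ (reverse xs) [ x ] x z (inj₂ z∈rev) ⟩
      before (reverse xs) x z          ≡⟨ before-false (reverse xs) x z z∈rev x∉rev ⟩
      false                            ≡⟨ sym (before-here₂ x xs z y≢z) ⟩
      before (x ∷ xs) z x              ∎
      where
      open ≡-Reasoning
      z∈rev : z ∈ reverse xs
      z∈rev = ∈-reverse⁺ (∈-tail z∈ y≢z)
    cases (no x≢y) (yes refl) = begin
      before (reverse xs ++ [ x ]) y x ≡⟨ before-++ˡ (reverse xs) [ x ] y x (inj₁ y∈rev) ⟩
      before (reverse xs) y x          ≡⟨ before-true (reverse xs) y x y∈rev x∉rev ⟩
      true                             ≡⟨ sym (before-here x xs y) ⟩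
      before (x ∷ xs) x y              ∎
      where
      open ≡-Reasoning
      y∈rev : y ∈ reverse xs
      y∈rev = ∈-reverse⁺ (∈-tail y∈ x≢y)
    cases (no x≢y) (no x≢z) = begin
      before (reverse xs ++ [ x ]) y z ≡⟨ before-++ˡ (reverse xs) [ x ] y z (inj₁ (∈-reverse⁺ y∈xs)) ⟩
      before (reverse xs) y z          ≡⟨ before-reverse xs y z u y∈xs (∈-tail z∈ x≢z) y≢z ⟩
      before xs z y                    ≡⟨ sym (before-there x xs z y x≢z x≢y) ⟩
      before (x ∷ xs) z y              ∎
      where
      open ≡-Reasoning
      y∈xs : y ∈ xs
      y∈xs = ∈-tail y∈ x≢y

  orient-swap₁₂ : ∀ l a b c → a ≢ b → a ∈ l → orient l b a c ≡ not (orient l a b c)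
  orient-swap₁₂ l a b c a≢b a∈l rewrite before-flip l a b a≢b a∈l =
    xor-swap-negates (before l a b) (before l b c) (before l a c)

  orient-swap₂₃ : ∀ l a b c → b ≢ c → b ∈ l → orient l a c b ≡ not (orient l a b c)
  orient-swap₂₃ l a b c b≢c b∈l rewrite before-flip l b c b≢c b∈l
    | Bool.xor-comm (before l a c) (not (before l b c)) | Bool.xor-comm (before l a b) (before l b c) =
    xor-swap-negates (before l b c) (before l a b) (before l a c)

  orient-reverse : ∀ l a b c → Unique l → a ∈ l → b ∈ l → c ∈ l → a ≢ b → b ≢ c → a ≢ c →
                   orient (reverse l) a b c ≡ not (orient l a b c)
  orient-reverse l a b c u a∈ b∈ c∈ a≢b b≢c a≢c
    rewrite before-reverse l a b u a∈ b∈ a≢b | before-reverse l b c u b∈ c∈ b≢c | before-reverse l a c u a∈ c∈ a≢c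
          | before-flip l a b a≢b a∈ | before-flip l b c b≢c b∈ | before-flip l a c a≢c a∈ =
    xor-not-negates (before l a b) (before l b c) (before l a c)

  orient-filter : ∀ {P : Pred A Level.zero} (P? : Decidable P) l {a b c} → P a → P b → P c →
                  orient (filter P? l) a b c ≡ orient l a b c
  orient-filter P? l pa pb pc
    rewrite before-filter P? l pa pb | before-filter P? l pb pc | before-filter P? l pa pc = refl

  orient-cocycle : ∀ l a b c d →
    ((orient l a b c xor orient l a b d) xor orient l a c d) xor orient l b c d ≡ false
  orient-cocycle l a b c d =
    xor-pairs (before l a b) (before l b c) (before l a c) (before l b d) (before l a d) (before l c d)

  -- Reading the cyclic order u ++ a ∷ v starting after a: the orientation of
  -- a, y, z is the linear order of y and z in v ++ u.
  orient-rotate : ∀ u v a → Unique (u ++ a ∷ v) → ∀ {y z} → y ∈ v ++ u → z ∈ v ++ u →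
                  orient (u ++ a ∷ v) a y z ≡ before (v ++ u) y z
  orient-rotate u v a unique {y} {z} y∈ z∈ with unique-split u (a ∷ v) unique
  ... | _ , a∉v′ , disjoint = cases (∈-++⁻ v y∈) (∈-++⁻ v z∈)
    where
    L : List A
    L = u ++ a ∷ v
    a∉u : a ∉ u
    a∉u a∈u = disjoint (a∈u , here refl)
    a∉v : a ∉ v
    a∉v = Unique[x∷xs]⇒x∉xs a∉v′
    v∌u : ∀ {x} → x ∈ v → x ∉ u
    v∌u x∈v x∈u = disjoint (x∈u , there x∈v)
    u∌v : ∀ {x} → x ∈ u → x ∉ v
    u∌v x∈u x∈v = v∌u x∈v x∈u
    a-before-v : ∀ {x} → x ∈ v → before L a x ≡ true
    a-before-v x∈v = trans (before-++ʳ u (a ∷ v) a _ a∉u (v∌u x∈v)) (before-here a v _)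
    u-before-a : ∀ {x} → x ∈ u → before L a x ≡ false
    u-before-a x∈u = trans (before-++ˡ u (a ∷ v) a _ (inj₂ x∈u)) (before-false u a _ x∈u a∉u)
    cases : y ∈ v ⊎ y ∈ u → z ∈ v ⊎ z ∈ u → orient L a y z ≡ before (v ++ u) y z
    cases (inj₁ y∈v) (inj₁ z∈v)
      rewrite a-before-v y∈v | a-before-v z∈v | before-++ˡ v u y z (inj₁ y∈v)
            | before-++ʳ u (a ∷ v) y z (v∌u y∈v) (v∌u z∈v)
            | before-there a v y z (∉⇒≢ a∉v y∈v) (∉⇒≢ a∉v z∈v) = twice-not (before v y z)
      where
      twice-not : ∀ b → (true xor b) xor true ≡ b
      twice-not b = trans (Bool.xor-comm (not b) true) (Bool.not-involutive b)
    cases (inj₂ y∈u) (inj₂ z∈u)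
      rewrite u-before-a y∈u | u-before-a z∈u | before-++ʳ v u y z (u∌v y∈u) (u∌v z∈u)
            | before-++ˡ u (a ∷ v) y z (inj₁ y∈u) = Bool.xor-identityʳ (before u y z)
    cases (inj₁ y∈v) (inj₂ z∈u)
      rewrite a-before-v y∈v | u-before-a z∈u
            | before-++ˡ v u y z (inj₁ y∈v) | before-true v y z y∈v (u∌v z∈u)
            | before-++ˡ u (a ∷ v) y z (inj₂ z∈u) | before-false u y z z∈u (v∌u y∈v) = refl
    cases (inj₂ y∈u) (inj₁ z∈v)
      rewrite u-before-a y∈u | a-before-v z∈v
            | before-++ˡ v u y z (inj₂ z∈v) | before-false v y z z∈v (u∌v y∈u)
            | before-++ˡ u (a ∷ v) y z (inj₁ y∈u) | before-true u y z y∈u (v∌u z∈v) = refl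

  order-determines-list : ∀ P Q → Unique P → Unique Q → (∀ {y} → y ∈ P → y ∈ Q) → (∀ {y} → y ∈ Q → y ∈ P) →
    (∀ {y z} → y ∈ P → z ∈ P → y ≢ z → before P y z ≡ before Q y z) → P ≡ Q
  order-determines-list []      []      _ _ _ _ _ = refl
  order-determines-list []      (q ∷ Q) _ _ _ Q⊆P _ with Q⊆P (here refl)
  ... | ()
  order-determines-list (p ∷ P) []      _ _ P⊆Q _ _ with P⊆Q (here refl)
  ... | ()
  order-determines-list (p ∷ P) (q ∷ Q) (p≢ ∷ uP) (q≢ ∷ uQ) P⊆Q Q⊆P same = heads (p ≟ q)
    where
    p∉P : p ∉ P
    p∉P = Unique[x∷xs]⇒x∉xs (p≢ ∷ uP)
    heads : Dec (p ≡ q) → p ∷ P ≡ q ∷ Q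
    heads (yes refl) = cong (p ∷_) (order-determines-list P Q uP uQ
      (λ y∈P → ∈-tail (P⊆Q (there y∈P)) (∉⇒≢ p∉P y∈P))
      (λ y∈Q → ∈-tail (Q⊆P (there y∈Q)) (∉⇒≢ (Unique[x∷xs]⇒x∉xs (q≢ ∷ uQ)) y∈Q))
      λ {y} {z} y∈P z∈P y≢z → begin
        before P y z       ≡⟨ sym (before-there p P y z (∉⇒≢ p∉P y∈P) (∉⇒≢ p∉P z∈P)) ⟩
        before (p ∷ P) y z ≡⟨ same (there y∈P) (there z∈P) y≢z ⟩
        before (p ∷ Q) y z ≡⟨ before-there p Q y z (∉⇒≢ p∉P y∈P) (∉⇒≢ p∉P z∈P) ⟩
        before Q y z       ∎)
      where open ≡-Reasoning
    heads (no p≢q) with trans (sym (before-here p P q))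
                         (trans (same (here refl) (there (∈-tail (Q⊆P (here refl)) p≢q)) p≢q)
                                (before-here₂ q Q p (p≢q ∘ sym)))
    ... | ()

  drop-length-++ : ∀ (u w : List A) → drop (length u) (u ++ w) ≡ w
  drop-length-++ []      w = refl
  drop-length-++ (x ∷ u) w = drop-length-++ u w

  take-length-++ : ∀ (u w : List A) → take (length u) (u ++ w) ≡ u
  take-length-++ []      w = refl
  take-length-++ (x ∷ u) w = cong (x ∷_) (take-length-++ u w)

  orient-determines-cycle : ∀ L T → Unique L → Unique T → (∀ {y} → y ∈ L → y ∈ T) → (∀ {y} → y ∈ T → y ∈ L) →
    (∀ {a y z} → a ∈ T → y ∈ T → z ∈ T → a ≢ y → y ≢ z → a ≢ z → orient L a y z ≡ orient T a y z) →
    ∃ λ k → T ≡ drop k L ++ take k L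
  orient-determines-cycle [] [] _ _ _ _ _ = 0 , refl
  orient-determines-cycle (x ∷ L) [] _ _ L⊆T _ _ with L⊆T (here refl)
  ... | ()
  orient-determines-cycle L (a ∷ T) uL uT L⊆T T⊆L same with ∈-∃++ (T⊆L (here refl))
  ... | u , v , refl = length u , (begin
    a ∷ T                                           ≡⟨ cong (a ∷_) (sym rest) ⟩
    a ∷ v ++ u                                      ≡⟨ sym (cong₂ _++_ (drop-length-++ u (a ∷ v)) (take-length-++ u (a ∷ v))) ⟩
    drop (length u) L′ ++ take (length u) L′        ∎)
    where
    open ≡-Reasoning
    L′ : List A
    L′ = u ++ a ∷ v
    a∉T : a ∉ T
    a∉T = Unique[x∷xs]⇒x∉xs uT
    a∉vu : a ∉ v ++ u
    a∉vu a∈vu with unique-split u (a ∷ v) uL | ∈-++⁻ v a∈vu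
    ... | _ , a∉v , _        | inj₁ a∈v = Unique[x∷xs]⇒x∉xs a∉v a∈v
    ... | _ , _ , disjoint | inj₂ a∈u = disjoint (a∈u , here refl)
    unique-vu : Unique (v ++ u)
    unique-vu with unique-split u (a ∷ v) uL
    ... | uu , _ ∷ uv , disjoint = Unique.++⁺ uv uu (λ (y∈v , y∈u) → disjoint (y∈u , there y∈v))
    vu⊆L : ∀ {y} → y ∈ v ++ u → y ∈ L′
    vu⊆L y∈ with ∈-++⁻ v y∈
    ... | inj₁ y∈v = ∈-++⁺ʳ u (there y∈v)
    ... | inj₂ y∈u = ∈-++⁺ˡ y∈u
    L⊆vu : ∀ {y} → y ∈ L′ → a ≢ y → y ∈ v ++ u
    L⊆vu y∈ a≢y with ∈-++⁻ u y∈
    ... | inj₁ y∈u = ∈-++⁺ʳ v y∈u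
    ... | inj₂ y∈av = ∈-++⁺ˡ (∈-tail y∈av a≢y)
    vu⊆T : ∀ {y} → y ∈ v ++ u → y ∈ T
    vu⊆T y∈ = ∈-tail (L⊆T (vu⊆L y∈)) (∉⇒≢ a∉vu y∈)
    same-order : ∀ {y z} → y ∈ v ++ u → z ∈ v ++ u → y ≢ z → before (v ++ u) y z ≡ before T y z
    same-order {y} {z} y∈ z∈ y≢z = begin
      before (v ++ u) y z    ≡⟨ sym (orient-rotate u v a uL y∈ z∈) ⟩
      orient L′ a y z        ≡⟨ same (here refl) (there (vu⊆T y∈)) (there (vu⊆T z∈))
                                     (∉⇒≢ a∉vu y∈) y≢z (∉⇒≢ a∉vu z∈) ⟩
      orient (a ∷ T) a y z   ≡⟨ orient-rotate [] T a uT (∈-++⁺ˡ (vu⊆T y∈)) (∈-++⁺ˡ (vu⊆T z∈)) ⟩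
      before (T ++ []) y z   ≡⟨ cong (λ l → before l y z) (++-identityʳ T) ⟩
      before T y z           ∎
    rest : v ++ u ≡ T
    rest = order-determines-list (v ++ u) T unique-vu (tail uT) vu⊆T
      (λ y∈ → L⊆vu (T⊆L (there y∈)) (∉⇒≢ a∉T y∈)) same-order

  before-sorted : ∀ {_<_ : A → A → Set} → (∀ {x y} → x < y → ¬ y < x) →
                  ∀ {l j k} → AllPairs _<_ l → j ∈ l → j < k → before l j k ≡ true
  before-sorted {_<_} asym {x ∷ xs} {j} {k} (x<xs ∷ sorted) j∈l j<k = cases (x ≟ j) (x ≟ k)
    where
    cases : Dec (x ≡ j) → Dec (x ≡ k) → before (x ∷ xs) j k ≡ true
    cases (yes refl) _          = before-here x xs k
    cases (no x≢j)   (yes refl) = ⊥-elim (asym j<k (lookupAll x<xs (∈-tail j∈l x≢j)))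
    cases (no x≢j)   (no x≢k)   =
      trans (before-there x xs j k x≢j x≢k) (before-sorted asym sorted (∈-tail j∈l x≢j) j<k)

module _ {A B : Set} (_≟ᴬ_ : DecidableEquality A) (_≟ᴮ_ : DecidableEquality B)
         (h : A → B) (h-injective : ∀ {x y} → h x ≡ h y → x ≡ y) where
  open Orientation

  before-map : ∀ l y z → before _≟ᴮ_ (map h l) (h y) (h z) ≡ before _≟ᴬ_ l y z
  before-map []       y z = refl
  before-map (x ∷ xs) y z = cases (x ≟ᴬ y) (x ≟ᴬ z)
    where
    cases : Dec (x ≡ y) → Dec (x ≡ z) → before _≟ᴮ_ (map h (x ∷ xs)) (h y) (h z) ≡ before _≟ᴬ_ (x ∷ xs) y z
    cases (yes refl) _ = trans (before-here _≟ᴮ_ (h x) _ (h z)) (sym (before-here _≟ᴬ_ x xs z))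
    cases (no x≢y) (yes refl) =
      trans (before-here₂ _≟ᴮ_ (h x) _ (h y) (x≢y ∘ h-injective)) (sym (before-here₂ _≟ᴬ_ x xs y x≢y))
    cases (no x≢y) (no x≢z) =
      trans (before-there _≟ᴮ_ (h x) (map h xs) (h y) (h z) (x≢y ∘ h-injective) (x≢z ∘ h-injective))
            (trans (before-map xs y z) (sym (before-there _≟ᴬ_ x xs y z x≢y x≢z)))

  orient-map : ∀ l x y z → orient _≟ᴮ_ (map h l) (h x) (h y) (h z) ≡ orient _≟ᴬ_ l x y z
  orient-map l x y z rewrite before-map l x y | before-map l y z | before-map l x z = refl

open module FinOrientation {n : ℕ} = Orientation (_≟_ {n})

record Alternating {m : ℕ} (Q : Fin m → Set) (F : Fin m → Fin m → Fin m → Bool) : Set where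
  field
    swap₁₂ : ∀ {x y z} → Q x → Q y → x ≢ y → F y x z ≡ not (F x y z)
    swap₂₃ : ∀ {x y z} → Q y → Q z → y ≢ z → F x z y ≡ not (F x y z)

-- Two alternating functions agreeing on increasing triples agree on all
-- triples of distinct elements: every ordering is reached from the increasing
-- one by at most three neighbour transpositions.
alternating-agree : ∀ {m} {Q : Fin m → Set} {F G} → Alternating Q F → Alternating Q G →
  (∀ {x y z} → Q x → Q y → Q z → x < y → y < z → F x y z ≡ G x y z) →
  ∀ {x y z} → Q x → Q y → Q z → x ≢ y → y ≢ z → x ≢ z → F x y z ≡ G x y z
alternating-agree {Q = Q} {F} {G} altF altG sorted {x} {y} {z} qx qy qz x≢y y≢z x≢z =
  cases (<-cmp x y) (<-cmp y z) (<-cmp x z)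
  where
  module F = Alternating altF
  module G = Alternating altG
  swap₁₂ : ∀ {a b c} → Q a → Q b → a ≢ b → F a b c ≡ G a b c → F b a c ≡ G b a c
  swap₁₂ qa qb a≢b eq = trans (F.swap₁₂ qa qb a≢b) (trans (cong not eq) (sym (G.swap₁₂ qa qb a≢b)))
  swap₂₃ : ∀ {a b c} → Q b → Q c → b ≢ c → F a b c ≡ G a b c → F a c b ≡ G a c b
  swap₂₃ qb qc b≢c eq = trans (F.swap₂₃ qb qc b≢c) (trans (cong not eq) (sym (G.swap₂₃ qb qc b≢c)))
  y≢x : y ≢ x
  y≢x = x≢y ∘ sym
  z≢y : z ≢ y
  z≢y = y≢z ∘ sym
  z≢x : z ≢ x
  z≢x = x≢z ∘ sym
  cases : _ → _ → _ → F x y z ≡ G x y z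
  cases (tri< x<y _ _) (tri< y<z _ _) _              = sorted qx qy qz x<y y<z
  cases (tri< x<y _ _) (tri> _ _ z<y) (tri< x<z _ _) = swap₂₃ qz qy z≢y (sorted qx qz qy x<z z<y)
  cases (tri< x<y _ _) (tri> _ _ z<y) (tri> _ _ z<x) =
    swap₂₃ qz qy z≢y (swap₁₂ qz qx z≢x (sorted qz qx qy z<x x<y))
  cases (tri> _ _ y<x) (tri< y<z _ _) (tri< x<z _ _) = swap₁₂ qy qx y≢x (sorted qy qx qz y<x x<z)
  cases (tri> _ _ y<x) (tri< y<z _ _) (tri> _ _ z<x) =
    swap₁₂ qy qx y≢x (swap₂₃ qz qx z≢x (sorted qy qz qx y<z z<x))
  cases (tri> _ _ y<x) (tri> _ _ z<y) _ =
    swap₁₂ qy qx y≢x (swap₂₃ qz qx z≢x (swap₁₂ qz qy z≢y (sorted qz qy qx z<y y<x)))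
  cases (tri≈ _ x≡y _) _ _ = ⊥-elim (x≢y x≡y)
  cases _ (tri≈ _ y≡z _) _ = ⊥-elim (y≢z y≡z)
  cases _ _ (tri≈ _ x≡z _) = ⊥-elim (x≢z x≡z)

-- The induced cyclic order L i at h i and the relabelled
-- one T i then have the same elements and agree on all triples, hence
-- coincide up to rotation.
module Realisation {m n : ℕ} (Π : RotSys n) {S : RawRotSys m} (S-cyclic : ∀ i → IsCyclicOrderOmitting i (S i))
                   (h : Fin m → Fin n) (h-injective : Injective _≡_ _≡_ h) where

  π : Fin n → List (Fin n)
  π = proj₁ Π

  L T : Fin m → List (Fin n)
  L i = induced Π h i
  T i = map h (S i)

  S-omits : ∀ {i j} → j ∈ S i → j ≢ i
  S-omits {i} {j} = Equivalence.to (proj₂ (S-cyclic i) j)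
  S-contains : ∀ {i j} → j ≢ i → j ∈ S i
  S-contains {i} {j} = Equivalence.from (proj₂ (S-cyclic i) j)
  π-omits : ∀ {x y} → y ∈ π x → y ≢ x
  π-omits {x} {y} = Equivalence.to (proj₂ (proj₂ Π x) y)
  π-contains : ∀ {i j} → j ≢ i → h j ∈ π (h i)
  π-contains {i} {j} j≢i = Equivalence.from (proj₂ (proj₂ Π (h i)) (h j)) (j≢i ∘ h-injective)
  image : ∀ j → Any (λ k → h k ≡ h j) (allFin m)
  image j = Any.map (λ j≡k → cong h (sym j≡k)) (∈-allFin j)

  unique-L : ∀ i → Unique (L i)
  unique-L i = Unique.filter⁺ (InImage? h) (proj₁ (proj₂ Π (h i)))
  unique-T : ∀ i → Unique (T i)
  unique-T i = Unique.map⁺ h-injective (proj₁ (S-cyclic i))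

  T⊆L : ∀ i {y} → y ∈ T i → y ∈ L i
  T⊆L i y∈T with ∈-map⁻ h y∈T
  ... | j , j∈S , refl = ∈-filter⁺ (InImage? h) (π-contains (S-omits j∈S)) (image j)
  L⊆T : ∀ i {y} → y ∈ L i → y ∈ T i
  L⊆T i y∈L with ∈-filter⁻ (InImage? h) {xs = π (h i)} y∈L
  ... | y∈π , y∈image with satisfied y∈image
  ...   | j , refl = ∈-map⁺ h (S-contains λ { refl → π-omits y∈π refl })

  Fπ FS : Fin m → Fin m → Fin m → Fin m → Bool
  Fπ i x y z = orient (π (h i)) (h x) (h y) (h z)
  FS i = orient (S i)

  alternating-π : ∀ i → Alternating (_≢ i) (Fπ i)
  alternating-π i = record
    { swap₁₂ = λ {x} {y} {z} x≢i _ x≢y → orient-swap₁₂ (π (h i)) (h x) (h y) (h z) (x≢y ∘ h-injective) (π-contains x≢i)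
    ; swap₂₃ = λ {x} {y} {z} y≢i _ y≢z → orient-swap₂₃ (π (h i)) (h x) (h y) (h z) (y≢z ∘ h-injective) (π-contains y≢i)
    }
  alternating-S : ∀ i → Alternating (_≢ i) (FS i)
  alternating-S i = record
    { swap₁₂ = λ {x} {y} {z} x≢i _ x≢y → orient-swap₁₂ (S i) x y z x≢y (S-contains x≢i)
    ; swap₂₃ = λ {x} {y} {z} y≢i _ y≢z → orient-swap₂₃ (S i) x y z y≢z (S-contains y≢i)
    }

  SortedAgreement : Set
  SortedAgreement = ∀ i {x y z} → x ≢ i → y ≢ i → z ≢ i → x < y → y < z → Fπ i x y z ≡ FS i x y z

  agree : SortedAgreement → ∀ i {a y z} → a ∈ T i → y ∈ T i → z ∈ T i → a ≢ y → y ≢ z → a ≢ z →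
          orient (L i) a y z ≡ orient (T i) a y z
  agree sorted i a∈ y∈ z∈ a≢y y≢z a≢z with ∈-map⁻ h a∈ | ∈-map⁻ h y∈ | ∈-map⁻ h z∈
  ... | x₁ , x₁∈ , refl | x₂ , x₂∈ , refl | x₃ , x₃∈ , refl = begin
    orient (L i) (h x₁) (h x₂) (h x₃)      ≡⟨ orient-filter (InImage? h) (π (h i)) (image x₁) (image x₂) (image x₃) ⟩
    Fπ i x₁ x₂ x₃                          ≡⟨ alternating-agree (alternating-π i) (alternating-S i) (sorted i)
                                               (S-omits x₁∈) (S-omits x₂∈) (S-omits x₃∈)
                                               (a≢y ∘ cong h) (y≢z ∘ cong h) (a≢z ∘ cong h) ⟩
    FS i x₁ x₂ x₃                          ≡⟨ sym (orient-map _≟_ _≟_ h h-injective (S i) x₁ x₂ x₃) ⟩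
    orient (T i) (h x₁) (h x₂) (h x₃)      ∎
    where open ≡-Reasoning

  realise : SortedAgreement → HasSubsystemEquivTo Π S
  realise sorted = h , h-injective , λ i →
    orient-determines-cycle (L i) (T i) (unique-L i) (unique-T i) (L⊆T i) (T⊆L i) (agree sorted i)

open Realisation using (realise)

record OrientationType {m : ℕ} (S : RawRotSys m) (a b : Bool) : Set where
  field
    cyclic      : ∀ i → IsCyclicOrderOmitting i (S i)
    apex-below  : ∀ {i j k l} → j < k → k < l → j ≢ i → l ≢ i → i < k → orient (S i) j k l ≡ a
    apex-above  : ∀ {i j k l} → j < k → k < l → j ≢ i → l ≢ i → k < i → orient (S i) j k l ≡ b

inverse-type : ∀ {m} {S : RawRotSys m} {a b} → OrientationType S a b → OrientationType (inv S) (not a) (not b)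
inverse-type {S = S} type = record
  { cyclic     = λ i → unique-reverse (proj₁ (cyclic i)) , λ j →
                   mk⇔ (Equivalence.to (proj₂ (cyclic i) j) ∘ ∈-reverse⁻) (∈-reverse⁺ ∘ Equivalence.from (proj₂ (cyclic i) j))
  ; apex-below = λ j<k k<l j≢i l≢i i<k →
      trans (reversed j<k k<l j≢i (<⇒≢ i<k ∘ sym) l≢i) (cong not (apex-below j<k k<l j≢i l≢i i<k))
  ; apex-above = λ j<k k<l j≢i l≢i k<i →
      trans (reversed j<k k<l j≢i (<⇒≢ k<i) l≢i) (cong not (apex-above j<k k<l j≢i l≢i k<i))
  }
  where
  open OrientationType type
  member : ∀ {i j} → j ≢ i → j ∈ S i
  member {i} {j} = Equivalence.from (proj₂ (cyclic i) j)
  reversed : ∀ {i j k l} → j < k → k < l → j ≢ i → k ≢ i → l ≢ i →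
             orient (reverse (S i)) j k l ≡ not (orient (S i) j k l)
  reversed {i} {j} {k} {l} j<k k<l j≢i k≢i l≢i =
    orient-reverse (S i) j k l (proj₁ (cyclic i)) (member j≢i) (member k≢i) (member l≢i)
      (<⇒≢ j<k) (<⇒≢ k<l) (<⇒≢ (<-trans j<k k<l))

allFin-sorted : ∀ m → AllPairs _<_ (allFin m)
allFin-sorted m = AllPairs.tabulate⁺-< id

before-allFin : ∀ {m} {j k : Fin m} → j < k → before (allFin m) j k ≡ true
before-allFin j<k = before-sorted <-asym (allFin-sorted _) (∈-allFin _) j<k

after-allFin : ∀ {m} {j k : Fin m} → j < k → before (allFin m) k j ≡ false
after-allFin {m} {j} {k} j<k =
  trans (before-flip (allFin m) j k (<⇒≢ j<k) (∈-allFin j)) (cong not (before-allFin j<k))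

Cm-type : ∀ m → OrientationType (Cm m) true true
Cm-type m = record
  { cyclic     = λ i → Unique.filter⁺ (others i) (Unique.allFin⁺ m) , λ j →
                   mk⇔ (λ j∈ → proj₂ (∈-filter⁻ (others i) {xs = allFin m} j∈)) (∈-filter⁺ (others i) (∈-allFin j))
  ; apex-below = λ j<k k<l j≢i l≢i i<k → increasing j<k k<l j≢i (<⇒≢ i<k ∘ sym) l≢i
  ; apex-above = λ j<k k<l j≢i l≢i k<i → increasing j<k k<l j≢i (<⇒≢ k<i) l≢i
  }
  where
  others : ∀ i (j : Fin m) → _
  others i j = ¬? (j ≟ i)
  increasing : ∀ {i j k l} → j < k → k < l → j ≢ i → k ≢ i → l ≢ i → orient (Cm m i) j k l ≡ true
  increasing {i} j<k k<l j≢i k≢i l≢i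
    rewrite orient-filter (others i) (allFin m) j≢i k≢i l≢i
          | before-allFin j<k | before-allFin k<l | before-allFin (<-trans j<k k<l) = refl

module TmOrder (m : ℕ) (i : Fin m) where

  above below : List (Fin m)
  above = filter (i <?_) (reverse (allFin m))
  below = filter (_<? i) (allFin m)

  ∈-above : ∀ {j} → i < j → j ∈ above
  ∈-above i<j = ∈-filter⁺ (i <?_) (∈-reverse⁺ (∈-allFin _)) i<j
  ∈-below : ∀ {j} → j < i → j ∈ below
  ∈-below j<i = ∈-filter⁺ (_<? i) (∈-allFin _) j<i
  above-> : ∀ {j} → j ∈ above → i < j
  above-> j∈ = proj₂ (∈-filter⁻ (i <?_) {xs = reverse (allFin m)} j∈)
  below-< : ∀ {j} → j ∈ below → j < i
  below-< j∈ = proj₂ (∈-filter⁻ (_<? i) {xs = allFin m} j∈)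

  before-above : ∀ {x y} → i < x → i < y → x < y → before (Tm m i) x y ≡ false
  before-above {x} {y} i<x i<y x<y = begin
    before (above ++ below) x y    ≡⟨ before-++ˡ above below x y (inj₁ (∈-above i<x)) ⟩
    before above x y               ≡⟨ before-filter (i <?_) (reverse (allFin m)) i<x i<y ⟩
    before (reverse (allFin m)) x y ≡⟨ before-reverse (allFin m) x y (Unique.allFin⁺ m) (∈-allFin x) (∈-allFin y) (<⇒≢ x<y) ⟩
    before (allFin m) y x          ≡⟨ after-allFin x<y ⟩
    false                          ∎
    where open ≡-Reasoning

  before-below : ∀ {x y} → x < i → y < i → x < y → before (Tm m i) x y ≡ true
  before-below {x} {y} x<i y<i x<y = begin
    before (above ++ below) x y ≡⟨ before-++ʳ above below x y (<-asym x<i ∘ above->) (<-asym y<i ∘ above->) ⟩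
    before below x y            ≡⟨ before-filter (_<? i) (allFin m) x<i y<i ⟩
    before (allFin m) x y       ≡⟨ before-allFin x<y ⟩
    true                        ∎
    where open ≡-Reasoning

  before-below-above : ∀ {x y} → x < i → i < y → before (Tm m i) x y ≡ false
  before-below-above x<i i<y = trans (before-++ˡ above below _ _ (inj₂ (∈-above i<y)))
                                     (before-false above _ _ (∈-above i<y) (<-asym x<i ∘ above->))

Tm-type : ∀ m → OrientationType (Tm m) false true
Tm-type m = record
  { cyclic     = λ i → unique i , λ j → mk⇔ (omits i) (contains i)
  ; apex-below = apex-below
  ; apex-above = apex-above
  }
  where
  open TmOrder m
  unique : ∀ i → Unique (Tm m i)
  unique i = Unique.++⁺ (Unique.filter⁺ (i <?_) (unique-reverse (Unique.allFin⁺ m)))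
                        (Unique.filter⁺ (_<? i) (Unique.allFin⁺ m))
                        (λ (j∈above , j∈below) → <-asym (above-> i j∈above) (below-< i j∈below))
  omits : ∀ i {j} → j ∈ Tm m i → j ≢ i
  omits i j∈ refl with ∈-++⁻ (above i) j∈
  ... | inj₁ j∈above = <-irrefl refl (above-> i j∈above)
  ... | inj₂ j∈below = <-irrefl refl (below-< i j∈below)
  contains : ∀ i {j} → j ≢ i → j ∈ Tm m i
  contains i {j} j≢i with <-cmp j i
  ... | tri< j<i _ _ = ∈-++⁺ʳ (above i) (∈-below i j<i)
  ... | tri≈ _ j≡i _ = ⊥-elim (j≢i j≡i)
  ... | tri> _ _ i<j = ∈-++⁺ˡ (∈-above i i<j)
  apex-below : ∀ {i j k l} → j < k → k < l → j ≢ i → l ≢ i → i < k → orient (Tm m i) j k l ≡ false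
  apex-below {i} {j} {k} {l} j<k k<l j≢i _ i<k with <-cmp j i
  ... | tri< j<i _ _ rewrite before-below-above i j<i i<k | before-above i i<k (<-trans i<k k<l) k<l
                           | before-below-above i j<i (<-trans i<k k<l) = refl
  ... | tri≈ _ j≡i _ = ⊥-elim (j≢i j≡i)
  ... | tri> _ _ i<j rewrite before-above i i<j i<k j<k | before-above i i<k (<-trans i<k k<l) k<l
                           | before-above i i<j (<-trans i<k k<l) (<-trans j<k k<l) = refl
  apex-above : ∀ {i j k l} → j < k → k < l → j ≢ i → l ≢ i → k < i → orient (Tm m i) j k l ≡ true
  apex-above {i} {j} {k} {l} j<k k<l _ l≢i k<i with <-cmp l i
  ... | tri< l<i _ _ rewrite before-below i (<-trans j<k k<i) k<i j<k | before-below i k<i l<i k<l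
                           | before-below i (<-trans j<k k<i) l<i (<-trans j<k k<l) = refl
  ... | tri≈ _ l≡i _ = ⊥-elim (l≢i l≡i)
  ... | tri> _ _ i<l rewrite before-below i (<-trans j<k k<i) k<i j<k | before-below-above i k<i i<l
                           | before-below-above i (<-trans j<k k<i) i<l = refl

lookup-∷-⊆ : ∀ {A : Set} (xs : List A) (p : Fin (length xs)) {q t} →
             q ≤ toℕ p → t ⊆ drop (suc (toℕ p)) xs → lookup xs p ∷ t ⊆ drop q xs
lookup-∷-⊆ (x ∷ xs) zero    {zero}  _         t⊆ = refl ∷ t⊆
lookup-∷-⊆ (x ∷ xs) (suc p) {zero}  _         t⊆ = x ∷ʳ lookup-∷-⊆ xs p z≤n t⊆
lookup-∷-⊆ (x ∷ xs) (suc p) {suc q} (s≤s q≤p) t⊆ = lookup-∷-⊆ xs p q≤p t⊆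

module Enumeration {n m : ℕ} (H : List (Fin n)) (unique-H : Unique H) (m≤H : m ≤ length H) where

  position : Fin m → Fin (length H)
  position i = inject≤ i m≤H

  h : Fin m → Fin n
  h i = lookup H (position i)

  position-< : ∀ {i j} → i < j → suc (toℕ (position i)) ≤ toℕ (position j)
  position-< {i} {j} i<j rewrite toℕ-inject≤ i m≤H | toℕ-inject≤ j m≤H = i<j

  infixr 5 _∷⟨_⟩_
  _∷⟨_⟩_ : ∀ x {q t} → q ≤ toℕ (position x) → t ⊆ drop (suc (toℕ (position x))) H → h x ∷ t ⊆ drop q H
  x ∷⟨ q≤x ⟩ t⊆ = lookup-∷-⊆ H (position x) q≤x t⊆

  pair-⊆ : ∀ {i j} → i < j → h i ∷ h j ∷ [] ⊆ H
  pair-⊆ {i} {j} i<j = i ∷⟨ z≤n ⟩ j ∷⟨ position-< i<j ⟩ minimum _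

  quadruple-⊆ : ∀ {i j k l} → i < j → j < k → k < l → h i ∷ h j ∷ h k ∷ h l ∷ [] ⊆ H
  quadruple-⊆ {i} {j} {k} {l} i<j j<k k<l =
    i ∷⟨ z≤n ⟩ j ∷⟨ position-< i<j ⟩ k ∷⟨ position-< j<k ⟩ l ∷⟨ position-< k<l ⟩ minimum _

  distinct : ∀ {x y : Fin n} → Unique (x ∷ y ∷ []) → x ≢ y
  distinct ((x≢y ∷ []) ∷ _) = x≢y

  h-injective : Injective _≡_ _≡_ h
  h-injective {i} {j} hi≡hj with <-cmp i j
  ... | tri< i<j _ _ = ⊥-elim (distinct (unique-⊆ (pair-⊆ i<j) unique-H) hi≡hj)
  ... | tri≈ _ i≡j _ = i≡j
  ... | tri> _ _ j<i = ⊥-elim (distinct (unique-⊆ (pair-⊆ j<i) unique-H) (sym hi≡hj))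

apexColouring : ∀ {n} → (Fin n → List (Fin n)) → Fin 4 → List (Fin n) → Bool
apexColouring π zero                   (a ∷ b ∷ c ∷ d ∷ []) = orient (π a) b c d
apexColouring π (suc zero)             (a ∷ b ∷ c ∷ d ∷ []) = orient (π b) a c d
apexColouring π (suc (suc zero))       (a ∷ b ∷ c ∷ d ∷ []) = orient (π c) a b d
apexColouring π (suc (suc (suc zero))) (a ∷ b ∷ c ∷ d ∷ []) = orient (π d) a b c
apexColouring π _                      _                    = false

xor-three-one : ∀ s t → ((s xor s) xor s) xor t ≡ false → t ≡ s
xor-three-one true  true  _ = refl
xor-three-one false false _ = refl

xor-one-three : ∀ s t → ((t xor s) xor s) xor s ≡ false → t ≡ s
xor-one-three true  true  _ = refl
xor-one-three false false _ = refl

five-⊆ : ∀ {A : Set} (H : List A) → 5 ≤ length H →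
         ∃ λ ((x₀ , x₁ , x₂ , x₃ , x₄) : A × A × A × A × A) → x₀ ∷ x₁ ∷ x₂ ∷ x₃ ∷ x₄ ∷ [] ⊆ H
five-⊆ [] ()
five-⊆ (_ ∷ []) (s≤s ())
five-⊆ (_ ∷ _ ∷ []) (s≤s (s≤s ()))
five-⊆ (_ ∷ _ ∷ _ ∷ []) (s≤s (s≤s (s≤s ())))
five-⊆ (_ ∷ _ ∷ _ ∷ _ ∷ []) (s≤s (s≤s (s≤s (s≤s ()))))
five-⊆ (x₀ ∷ x₁ ∷ x₂ ∷ x₃ ∷ x₄ ∷ rest) _ =
  (x₀ , x₁ , x₂ , x₃ , x₄) , refl ∷ refl ∷ refl ∷ refl ∷ refl ∷ minimum rest

module Cocycle {n : ℕ} (π : Fin n → List (Fin n)) (H : List (Fin n)) (colour : Fin 4 → Bool)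
               (homogeneous : ∀ c → Homogeneous 4 (apexColouring π c) H (colour c)) (five≤H : 5 ≤ length H) where

  xor₄-cong : ∀ {a b c d a′ b′ c′ d′} → a ≡ a′ → b ≡ b′ → c ≡ c′ → d ≡ d′ →
              ((a xor b) xor c) xor d ≡ ((a′ xor b′) xor c′) xor d′
  xor₄-cong refl refl refl refl = refl

  first≡second : colour zero ≡ colour (suc zero)
  first≡second with five-⊆ H five≤H
  ... | (x₀ , x₁ , x₂ , x₃ , x₄) , ⊆H = xor-three-one (colour (suc zero)) (colour zero) (begin
    ((colour (suc zero) xor colour (suc zero)) xor colour (suc zero)) xor colour zero
      ≡⟨ sym (xor₄-cong (col (suc zero) (refl ∷ refl ∷ refl ∷ refl ∷ x₄ ∷ʳ []) refl)
                        (col (suc zero) (refl ∷ refl ∷ refl ∷ x₃ ∷ʳ refl ∷ []) refl)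
                        (col (suc zero) (refl ∷ refl ∷ x₂ ∷ʳ refl ∷ refl ∷ []) refl)
                        (col zero       (x₀ ∷ʳ refl ∷ refl ∷ refl ∷ refl ∷ []) refl)) ⟩
    ((orient (π x₁) x₀ x₂ x₃ xor orient (π x₁) x₀ x₂ x₄) xor orient (π x₁) x₀ x₃ x₄) xor orient (π x₁) x₂ x₃ x₄
      ≡⟨ orient-cocycle (π x₁) x₀ x₂ x₃ x₄ ⟩
    false ∎)
    where
    open ≡-Reasoning
    col : ∀ c {t} → t ⊆ x₀ ∷ x₁ ∷ x₂ ∷ x₃ ∷ x₄ ∷ [] → length t ≡ 4 → apexColouring π c t ≡ colour c
    col c t⊆ = homogeneous c _ (⊆-trans t⊆ ⊆H)

  third≡fourth : colour (suc (suc zero)) ≡ colour (suc (suc (suc zero)))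
  third≡fourth with five-⊆ H five≤H
  ... | (x₀ , x₁ , x₂ , x₃ , x₄) , ⊆H = sym (xor-one-three (colour (suc (suc zero))) (colour (suc (suc (suc zero)))) (begin
    ((colour (suc (suc (suc zero))) xor colour (suc (suc zero))) xor colour (suc (suc zero))) xor colour (suc (suc zero))
      ≡⟨ sym (xor₄-cong (col (suc (suc (suc zero))) (refl ∷ refl ∷ refl ∷ refl ∷ x₄ ∷ʳ []) refl)
                        (col (suc (suc zero)) (refl ∷ refl ∷ x₂ ∷ʳ refl ∷ refl ∷ []) refl)
                        (col (suc (suc zero)) (refl ∷ x₁ ∷ʳ refl ∷ refl ∷ refl ∷ []) refl)
                        (col (suc (suc zero)) (x₀ ∷ʳ refl ∷ refl ∷ refl ∷ refl ∷ []) refl)) ⟩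
    ((orient (π x₃) x₀ x₁ x₂ xor orient (π x₃) x₀ x₁ x₄) xor orient (π x₃) x₀ x₂ x₄) xor orient (π x₃) x₁ x₂ x₄
      ≡⟨ orient-cocycle (π x₃) x₀ x₁ x₂ x₄ ⟩
    false ∎))
    where
    open ≡-Reasoning
    col : ∀ c {t} → t ⊆ x₀ ∷ x₁ ∷ x₂ ∷ x₃ ∷ x₄ ∷ [] → length t ≡ 4 → apexColouring π c t ≡ colour c
    col c t⊆ = homogeneous c _ (⊆-trans t⊆ ⊆H)

realise-type : ∀ {m n} (Π : RotSys n) (H : List (Fin n)) → Unique H → m ≤ length H → ∀ {a b} →
  Homogeneous 4 (apexColouring (proj₁ Π) zero) H a →
  Homogeneous 4 (apexColouring (proj₁ Π) (suc zero)) H a →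
  Homogeneous 4 (apexColouring (proj₁ Π) (suc (suc zero))) H b →
  Homogeneous 4 (apexColouring (proj₁ Π) (suc (suc (suc zero)))) H b →
  ∀ {S} → OrientationType S a b → HasSubsystemEquivTo Π S
realise-type Π H unique-H m≤H hom₁ hom₂ hom₃ hom₄ {S} type = realise Π cyclic h h-injective sorted
  where
  open Enumeration H unique-H m≤H
  open OrientationType type
  -- the position of the apex i among x < y < z selects the colouring
  sorted : ∀ i {x y z} → x ≢ i → y ≢ i → z ≢ i → x < y → y < z →
           orient (proj₁ Π (h i)) (h x) (h y) (h z) ≡ orient (S i) x y z
  sorted i {x} {y} {z} x≢i y≢i z≢i x<y y<z with <-cmp i y | <-cmp i x | <-cmp i z
  ... | tri< i<y _ _ | tri< i<x _ _ | _ =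
    trans (hom₁ _ (quadruple-⊆ i<x x<y y<z) refl) (sym (apex-below x<y y<z x≢i z≢i i<y))
  ... | tri< i<y _ _ | tri> _ _ x<i | _ =
    trans (hom₂ _ (quadruple-⊆ x<i i<y y<z) refl) (sym (apex-below x<y y<z x≢i z≢i i<y))
  ... | tri> _ _ y<i | _ | tri< i<z _ _ =
    trans (hom₃ _ (quadruple-⊆ x<y y<i i<z) refl) (sym (apex-above x<y y<z x≢i z≢i y<i))
  ... | tri> _ _ y<i | _ | tri> _ _ z<i =
    trans (hom₄ _ (quadruple-⊆ x<y y<z z<i) refl) (sym (apex-above x<y y<z x≢i z≢i y<i))
  ... | tri≈ _ i≡y _ | _ | _ = ⊥-elim (y≢i (sym i≡y))
  ... | _ | tri≈ _ i≡x _ | _ = ⊥-elim (x≢i (sym i≡x))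
  ... | _ | _ | tri≈ _ i≡z _ = ⊥-elim (z≢i (sym i≡z))

ContainsModel : ∀ {n} → ℕ → RotSys n → Set
ContainsModel m Π = HasSubsystemEquivTo Π (Cm m) ⊎ HasSubsystemEquivTo Π (Tm m) ⊎
                    HasSubsystemEquivTo Π (inv (Cm m)) ⊎ HasSubsystemEquivTo Π (inv (Tm m))

realise-one-of-four : ∀ m {n} (Π : RotSys n) a b →
  (∀ {S : RawRotSys m} → OrientationType S a b → HasSubsystemEquivTo Π S) → ContainsModel m Π
realise-one-of-four m Π true  true  realise-S = inj₁ (realise-S (Cm-type m))
realise-one-of-four m Π false true  realise-S = inj₂ (inj₁ (realise-S (Tm-type m)))
realise-one-of-four m Π false false realise-S = inj₂ (inj₂ (inj₁ (realise-S (inverse-type (Cm-type m)))))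
realise-one-of-four m Π true  false realise-S = inj₂ (inj₂ (inj₂ (realise-S (inverse-type (Tm-type m)))))

theorem2 : (m : ℕ) → 1 ≤ m → ∃ λ (n₀ : ℕ) → (n : ℕ) → n₀ ≤ n → (Π : RotSys n) →
    HasSubsystemEquivTo Π (Cm m) ⊎ HasSubsystemEquivTo Π (Tm m) ⊎
    HasSubsystemEquivTo Π (inv (Cm m)) ⊎ HasSubsystemEquivTo Π (inv (Tm m))
theorem2 m _ = n₀ , contains
  where
  n₀ : ℕ
  n₀ = proj₁ (ramsey-simultaneous 4 (m + 5) 4)
  contains : ∀ n → n₀ ≤ n → (Π : RotSys n) → ContainsModel m Π
  contains n n₀≤n Π with proj₂ (ramsey-simultaneous 4 (m + 5) 4) (allFin n) (≤-trans n₀≤n (≤-reflexive (sym (length-tabulate id)))) (apexColouring (proj₁ Π))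
  ... | H , H⊆allFin , m+5≤H , homogeneous =
    realise-one-of-four m Π (colour zero) (colour (suc (suc zero)))
      (realise-type Π H (unique-⊆ H⊆allFin (Unique.allFin⁺ n)) (≤-trans (m≤m+n m 5) m+5≤H)
        (hom zero) (subst (Homogeneous 4 _ H) (sym first≡second) (hom (suc zero)))
        (hom (suc (suc zero))) (subst (Homogeneous 4 _ H) (sym third≡fourth) (hom (suc (suc (suc zero))))))
    where
    colour : Fin 4 → Bool
    colour c = proj₁ (homogeneous c)
    hom : ∀ c → Homogeneous 4 (apexColouring (proj₁ Π) c) H (colour c)
    hom c = proj₂ (homogeneous c)
    open Cocycle (proj₁ Π) H colour hom (≤-trans (m≤n+m 5 m) m+5≤H)
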